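{- In the read/write streams model with two streams, the minimum period of a string of length $n$ can be computed using $O(\log n)$ bits of internal memory and $O(\log^2 n)$ passes.
   Context: Read/write streams model: an algorithm has an internal memory of $m$ bits and access to a fixed number of streams (tapes); each stream is a sequence of cells accessed sequentially by a read/write head; a pass is one sequential sweep over a stream. The input string is initially on the first stream. The minimum period of $s$ is the least $\ell\ge1$ with $s[i]=s[i+\ell]$ for all $1\le i\le n-\ell$. -}

module Defs where

open import Data.Nat using (ℕ; zero; suc; _+_; _≤_)
open import Data.Fin using (Fin; toℕ)
open import Data.Vec using (Vec; lookup; []; _∷_)
open import Data.List using (List; []; _∷_; length)
open import Data.Bool using (Bool)
open import Data.Maybe using (Maybe; just; nothing)
open import Data.Product using (_×_)
open import Relation.Binary.PropositionalEquality using (_≡_)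

IsPeriod : ∀ {σ n} → Vec (Fin σ) n → ℕ → Set
IsPeriod {σ} {n} s ℓ =
  1 ≤ ℓ × (∀ (i j : Fin n) → toℕ j ≡ toℕ i + ℓ → lookup s i ≡ lookup s j)

IsMinPeriod : ∀ {σ n} → Vec (Fin σ) n → ℕ → Set
IsMinPeriod s ℓ = IsPeriod s ℓ × (∀ ℓ′ → IsPeriod s ℓ′ → ℓ ≤ ℓ′)

-- Each stream is a (two-way infinite, blank padded) tape over a finite
-- tape alphabet Fin k, with one read/write head.  The internal memory is a
-- bit string (List Bool); its size is its length.  A pass over a stream is a maximal
-- sweep in one direction, so the number of passes over a stream is
-- 1 + the number of head reversals on it.

data Move : Set where
  mvL mvR stay : Move

data Dir : Set where
  dL dR : Dir

data Action (k : ℕ) : Set where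
  halt : ℕ → Action k
  step : List Bool → Fin k → Fin k → Move → Move → Action k

record Machine (σ : ℕ) : Set where
  field
    k     : ℕ
    blank : Fin k
    inj   : Fin σ → Fin k
    mem₀  : List Bool
    δ     : List Bool → Fin k → Fin k → Action k

record Tape (k : ℕ) : Set where
  constructor tape
  field
    lft  : List (Fin k)   -- cells left of the head, nearest first
    cur  : Fin k
    rgt  : List (Fin k)   -- cells right of the head, nearest first

record HeadLog : Set where
  constructor hlog
  field
    lastDir   : Maybe Dir
    reversals : ℕ

record Config (k : ℕ) : Set where
  constructor config
  field
    mem  : List Bool
    t₁   : Tape k
    t₂   : Tape k
    h₁   : HeadLog
    h₂   : HeadLog

moveTape : ∀ {k} → Fin k → Move → Tape k → Tape k
moveTape b mvL  (tape []       c r) = tape [] b (c ∷ r)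
moveTape b mvL  (tape (x ∷ l)  c r) = tape l x (c ∷ r)
moveTape b mvR  (tape l c [])       = tape (c ∷ l) b []
moveTape b mvR  (tape l c (x ∷ r))  = tape (c ∷ l) x r
moveTape b stay t                   = t

writeTape : ∀ {k} → Fin k → Tape k → Tape k
writeTape a (tape l _ r) = tape l a r

sameDir : Dir → Dir → Bool
sameDir dL dL = Bool.true
sameDir dR dR = Bool.true
sameDir _  _  = Bool.false

logDir : Dir → HeadLog → HeadLog
logDir d (hlog nothing  r) = hlog (just d) r
logDir d (hlog (just e) r) with sameDir d e
... | Bool.true  = hlog (just d) r
... | Bool.false = hlog (just d) (suc r)

logMove : Move → HeadLog → HeadLog
logMove mvL  h = logDir dL h
logMove mvR  h = logDir dR h
logMove stay h = h

passesOf : HeadLog → ℕ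
passesOf (hlog _ r) = suc r

module _ {σ : ℕ} (M : Machine σ) where
  open Machine M

  inputTape : ∀ {n} → Vec (Fin σ) n → Tape k
  inputTape []       = tape [] blank []
  inputTape (a ∷ w)  = tape [] (inj a) (toList w)
    where
    toList : ∀ {m} → Vec (Fin σ) m → List (Fin k)
    toList []      = []
    toList (x ∷ v) = inj x ∷ toList v

  initConfig : ∀ {n} → Vec (Fin σ) n → Config k
  initConfig w =
    config mem₀ (inputTape w) (tape [] blank []) (hlog nothing 0) (hlog nothing 0)

  after : Config k → List Bool → Fin k → Fin k → Move → Move → Config k
  after (config _ t₁ t₂ h₁ h₂) m′ a₁ a₂ d₁ d₂ =
    config m′ (moveTape blank d₁ (writeTape a₁ t₁))
              (moveTape blank d₂ (writeTape a₂ t₂))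
              (logMove d₁ h₁) (logMove d₂ h₂)

  data Runs (m p : ℕ) : Config k → ℕ → Set where
    halts : ∀ {c o} →
      δ (Config.mem c) (Tape.cur (Config.t₁ c)) (Tape.cur (Config.t₂ c)) ≡ halt o →
      length (Config.mem c) ≤ m →
      passesOf (Config.h₁ c) + passesOf (Config.h₂ c) ≤ p →
      Runs m p c o
    steps : ∀ {c o m′ a₁ a₂ d₁ d₂} →
      δ (Config.mem c) (Tape.cur (Config.t₁ c)) (Tape.cur (Config.t₂ c))
        ≡ step m′ a₁ a₂ d₁ d₂ →
      length (Config.mem c) ≤ m →
      Runs m p (after c m′ a₁ a₂ d₁ d₂) o →
      Runs m p c o

  ComputesWithin : ∀ {n} → Vec (Fin σ) n → (m p o : ℕ) → Set
  ComputesWithin w m p o = Runs m p (initConfig w) o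

module Submission where

-- The machine counts the n letters of w in binary and writes a separator, so
-- stream 1 holds the block w#.  It then doubles the contents of stream 1 (copy
-- them to stream 2, append them back) until there are N ≥ n + 3 blocks; each
-- round costs four passes, so there are O(log n) rounds.  Finally it copies
-- (w#)^N onto stream 2 as well and tests all shifts j = 0, 1, …, n in a single
-- joint sweep: head 2 skips separators while head 1 does not, so whenever
-- head 1 is at letter i of its j-th block, head 2 is at letter i + j of the
-- concatenation w w w ….  The sweep stops at the end of the first block j ≥ 1
-- on which no mismatch w[i] ≠ w[i + j] (with i + j < n) was seen; j = n always
-- qualifies.  The memory holds a four-bit tag and at most three counters below
-- 2(n + 3), in a binary prefix code, hence O(log n) bits.

open import Defs
open import Data.Bool using (Bool; true; false; _∧_)
open import Data.Fin using (Fin; toℕ; fromℕ<)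
import Data.Fin as Fin
open import Data.Fin.Properties using (toℕ-fromℕ<; toℕ<n; toℕ-injective; fromℕ<-cong)
open import Data.List using (List; []; _∷_; _++_; drop; _ʳ++_; length; map; concatMap; replicate; reverse)
open import Data.List.Properties
  using (++-assoc; ++-identityʳ; ++-ʳ++; length-++; length-ʳ++; length-map; length-reverse; ʳ++-defn;
         reverse-involutive)
open import Data.List.Relation.Unary.All using (All; []; _∷_)
open import Data.Maybe using (Maybe; just; nothing)
import Data.Maybe as Maybe
open import Data.Nat using (ℕ; zero; suc; _+_; _*_; _^_; _≤_; _<_; _≤?_; _<?_; z≤n; s≤s)
open import Data.Nat.Binary as Bin using (ℕᵇ; 2[1+_]; 1+[2_])
open import Data.Nat.Binary.Properties as Bin using ()
open import Data.Nat.Logarithm using (⌊log₂_⌋; ⌊log₂⌋-mono-≤; ⌊log₂[2^n]⌋≡n)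
open import Data.Nat.Properties
open import Data.Nat.Tactic.RingSolver using (solve-∀)
open import Data.Product using (Σ; _×_; _,_; proj₁; proj₂)
open import Data.Unit using (⊤; tt)
open import Data.Sum using (inj₁; inj₂)
open import Data.Vec using (Vec; lookup)
import Data.Vec as Vec
open import Data.Vec.Properties using (length-toList)
open import Function using (id; _∘_)
open import Relation.Nullary using (¬_; Dec; yes; no; does; proof; contradiction)
open import Relation.Nullary.Reflects using (Reflects; ofʸ; ofⁿ)
open import Relation.Binary.PropositionalEquality

-- A prefix code for natural numbers

codeᵇ : ℕᵇ → List Bool
codeᵇ Bin.zero     = false ∷ []
codeᵇ 2[1+ x ] = true ∷ false ∷ codeᵇ x
codeᵇ 1+[2 x ] = true ∷ true ∷ codeᵇ x

code : ℕ → List Bool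
code = codeᵇ ∘ Bin.fromℕ

codes : List ℕ → List Bool
codes = concatMap code

mutual
  decodeAll : List Bool → Maybe (List ℕ)
  decodeAll []       = just []
  decodeAll (b ∷ bs) = decodeDigits id (b ∷ bs)

  decodeDigits : (ℕᵇ → ℕᵇ) → List Bool → Maybe (List ℕ)
  decodeDigits k (false ∷ bs)        = Maybe.map (Bin.toℕ (k Bin.zero) ∷_) (decodeAll bs)
  decodeDigits k (true ∷ false ∷ bs) = decodeDigits (k ∘ 2[1+_]) bs
  decodeDigits k (true ∷ true ∷ bs)  = decodeDigits (k ∘ 1+[2_]) bs
  decodeDigits k _                   = nothing

decodeDigits-codeᵇ : ∀ k x bs →
  decodeDigits k (codeᵇ x ++ bs) ≡ Maybe.map (Bin.toℕ (k x) ∷_) (decodeAll bs)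
decodeDigits-codeᵇ k Bin.zero     bs = refl
decodeDigits-codeᵇ k 2[1+ x ] bs = decodeDigits-codeᵇ (k ∘ 2[1+_]) x bs
decodeDigits-codeᵇ k 1+[2 x ] bs = decodeDigits-codeᵇ (k ∘ 1+[2_]) x bs

decodeAll-codeᵇ : ∀ x bs → decodeAll (codeᵇ x ++ bs) ≡ Maybe.map (Bin.toℕ x ∷_) (decodeAll bs)
decodeAll-codeᵇ Bin.zero     bs = refl
decodeAll-codeᵇ 2[1+ x ] bs = decodeDigits-codeᵇ 2[1+_] x bs
decodeAll-codeᵇ 1+[2 x ] bs = decodeDigits-codeᵇ 1+[2_] x bs

decodeAll-codes : ∀ xs → decodeAll (codes xs) ≡ just xs
decodeAll-codes []       = refl
decodeAll-codes (x ∷ xs) = begin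
  decodeAll (code x ++ codes xs)
    ≡⟨ decodeAll-codeᵇ (Bin.fromℕ x) (codes xs) ⟩
  Maybe.map (Bin.toℕ (Bin.fromℕ x) ∷_) (decodeAll (codes xs))
    ≡⟨ cong₂ (λ y → Maybe.map (y ∷_)) (Bin.toℕ-fromℕ x) (decodeAll-codes xs) ⟩
  just (x ∷ xs)
    ∎
  where open ≡-Reasoning

length-codeᵇ : ∀ K x → Bin.toℕ x < 2 ^ K → length (codeᵇ x) ≤ 1 + K * 2
length-codeᵇ K       Bin.zero _ = s≤s z≤n
length-codeᵇ zero 2[1+ x ] (s≤s ())
length-codeᵇ zero 1+[2 x ] (s≤s ())
length-codeᵇ (suc K) 2[1+ x ] x< =
  s≤s (s≤s (length-codeᵇ K x (<-trans (n<1+n _) (*-cancelˡ-< 2 _ _ x<))))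
length-codeᵇ (suc K) 1+[2 x ] x< =
  s≤s (s≤s (length-codeᵇ K x (*-cancelˡ-< 2 _ _ (<-trans (n<1+n _) x<))))

length-codes : ∀ K {xs} → All (_< 2 ^ K) xs → length (codes xs) ≤ length xs * (1 + K * 2)
length-codes K []                 = z≤n
length-codes K {x ∷ xs} (x< ∷ xs<) = begin
  length (code x ++ codes xs)           ≡⟨ length-++ (code x) ⟩
  length (code x) + length (codes xs)   ≤⟨ +-mono-≤ (length-codeᵇ K (Bin.fromℕ x) x<′) (length-codes K xs<) ⟩
  (1 + K * 2) + length xs * (1 + K * 2) ∎
  where
  open ≤-Reasoning
  x<′ : Bin.toℕ (Bin.fromℕ x) < 2 ^ K
  x<′ = subst (_< 2 ^ K) (sym (Bin.toℕ-fromℕ x)) x<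

-- Shift invariance and minimal periods

module _ {a} {A : Set a} {n : ℕ} (w : Vec A n) where

  ShiftInvariant : ℕ → Set a
  ShiftInvariant j = ∀ (x y : Fin n) → toℕ y ≡ toℕ x + j → lookup w x ≡ lookup w y

  ShiftInvariantBelow : ℕ → ℕ → Set a
  ShiftInvariantBelow j i =
    ∀ (x y : Fin n) → toℕ y ≡ toℕ x + j → toℕ x < i → lookup w x ≡ lookup w y

  ShiftInvariantAt : ℕ → (i : ℕ) → i < n → Set a
  ShiftInvariantAt j i i<n = (q : i + j < n) → lookup w (fromℕ< i<n) ≡ lookup w (fromℕ< q)

  shiftInvariantBelow-zero : ∀ j → ShiftInvariantBelow j 0
  shiftInvariantBelow-zero j x y eq ()

  shiftInvariantBelow-pred : ∀ {j i} → ShiftInvariantBelow j (suc i) → ShiftInvariantBelow j i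
  shiftInvariantBelow-pred inv x y eq x<i = inv x y eq (m<n⇒m<1+n x<i)

  shiftInvariantBelow-at : ∀ {j i} (i<n : i < n) →
    ShiftInvariantBelow j (suc i) → ShiftInvariantAt j i i<n
  shiftInvariantBelow-at {j} i<n inv q = inv (fromℕ< i<n) (fromℕ< q)
    (trans (toℕ-fromℕ< q) (cong (_+ j) (sym (toℕ-fromℕ< i<n))))
    (s≤s (≤-reflexive (toℕ-fromℕ< i<n)))

  shiftInvariantBelow-suc : ∀ {j i} (i<n : i < n) →
    ShiftInvariantBelow j i → ShiftInvariantAt j i i<n → ShiftInvariantBelow j (suc i)
  shiftInvariantBelow-suc {j} {i} i<n below at x y eq x<1+i with m<1+n⇒m<n∨m≡n x<1+i
  ... | inj₁ x<i = below x y eq x<i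
  ... | inj₂ x≡i = begin
    lookup w x             ≡⟨ cong (lookup w) (toℕ-injective (trans x≡i (sym (toℕ-fromℕ< i<n)))) ⟩
    lookup w (fromℕ< i<n)  ≡⟨ at y<n ⟩
    lookup w (fromℕ< y<n)  ≡⟨ cong (lookup w) (toℕ-injective (trans (toℕ-fromℕ< y<n) (sym y≡))) ⟩
    lookup w y             ∎
    where
    open ≡-Reasoning
    y≡ : toℕ y ≡ i + j
    y≡ = trans eq (cong (_+ j) x≡i)
    y<n : i + j < n
    y<n = subst (_< n) y≡ (toℕ<n y)

  shiftInvariantBelow-suc-reflects : ∀ {j i ok check} (i<n : i < n) →
    Reflects (ShiftInvariantBelow j i) ok → Reflects (ShiftInvariantAt j i i<n) check →
    Reflects (ShiftInvariantBelow j (suc i)) (ok ∧ check)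
  shiftInvariantBelow-suc-reflects i<n (ofʸ below) (ofʸ at) = ofʸ (shiftInvariantBelow-suc i<n below at)
  shiftInvariantBelow-suc-reflects i<n (ofʸ below) (ofⁿ ¬at) = ofⁿ (¬at ∘ shiftInvariantBelow-at i<n)
  shiftInvariantBelow-suc-reflects i<n (ofⁿ ¬below) _ = ofⁿ (¬below ∘ shiftInvariantBelow-pred)

  shiftInvariantBelow-length : ∀ {j} → ShiftInvariantBelow j n → ShiftInvariant j
  shiftInvariantBelow-length inv x y eq = inv x y eq (toℕ<n x)

  shiftInvariant⇒below : ∀ {j i} → ShiftInvariant j → ShiftInvariantBelow j i
  shiftInvariant⇒below inv x y eq _ = inv x y eq

  shiftInvariant-length : ShiftInvariant n
  shiftInvariant-length x y eq =
    contradiction (toℕ<n y) (≤⇒≯ (≤-trans (m≤n+m n (toℕ x)) (≤-reflexive (sym eq))))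

  NoShorterPeriod : ℕ → Set a
  NoShorterPeriod j = ∀ j′ → 1 ≤ j′ → j′ < j → ¬ ShiftInvariant j′

module _ {σ n : ℕ} (w : Vec (Fin σ) n) where

  isMinPeriod : ∀ {j} → 1 ≤ j → ShiftInvariant w j → NoShorterPeriod w j → IsMinPeriod w j
  isMinPeriod {j} 1≤j inv none = (1≤j , inv) , minimal
    where
    minimal : ∀ ℓ → IsPeriod w ℓ → j ≤ ℓ
    minimal ℓ (1≤ℓ , invℓ) with j ≤? ℓ
    ... | yes j≤ℓ = j≤ℓ
    ... | no  j≰ℓ = contradiction invℓ (none ℓ 1≤ℓ (≰⇒> j≰ℓ))

  noShorterPeriod-suc : ∀ {j} → NoShorterPeriod w j → ¬ IsPeriod w j → NoShorterPeriod w (suc j)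
  noShorterPeriod-suc none ¬period j′ 1≤j′ j′<1+j inv with m<1+n⇒m<n∨m≡n j′<1+j
  ... | inj₁ j′<j  = none j′ 1≤j′ j′<j inv
  ... | inj₂ refl = ¬period (1≤j′ , inv)

  non-period<length : ∀ {j} → 1 ≤ n → j ≤ n → ¬ IsPeriod w j → j < n
  non-period<length 1≤n j≤n ¬period =
    ≤∧≢⇒< j≤n (λ { refl → ¬period (1≤n , shiftInvariant-length w) })

copies : ∀ {a} {A : Set a} → ℕ → List A → List A
copies zero    xs = []
copies (suc N) xs = xs ++ copies N xs

copies-+ : ∀ {a} {A : Set a} M N (xs : List A) → copies M xs ++ copies N xs ≡ copies (M + N) xs
copies-+ zero    N xs = refl
copies-+ (suc M) N xs = trans (++-assoc xs (copies M xs) (copies N xs)) (cong (xs ++_) (copies-+ M N xs))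

quotient-zero : ∀ {n u e t} → u + n * e ≡ t → t < n → e ≡ 0
quotient-zero {e = zero} _ _ = refl
quotient-zero {n} {u} {suc e} {t} eq t<n = contradiction t<n (≤⇒≯ (begin
  n             ≤⟨ m≤m+n n (n * e) ⟩
  n + n * e     ≡⟨ sym (*-suc n e) ⟩
  n * suc e     ≤⟨ m≤n+m _ u ⟩
  u + n * suc e ≡⟨ eq ⟩
  t             ∎))
  where open ≤-Reasoning

quotient-suc : ∀ {n u e j} → u < n → u + n * e ≡ n + j → Σ ℕ λ e′ → e ≡ suc e′ × u + n * e′ ≡ j
quotient-suc {n} {u} {zero} {j} u<n eq = contradiction u<n (≤⇒≯ (begin
  n         ≤⟨ m≤m+n n j ⟩
  n + j     ≡⟨ sym eq ⟩
  u + n * 0 ≡⟨ cong (u +_) (*-zeroʳ n) ⟩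
  u + 0     ≡⟨ +-identityʳ u ⟩
  u         ∎))
  where open ≤-Reasoning
quotient-suc {n} {u} {suc e} {j} u<n eq = e , refl , +-cancelˡ-≡ n _ _ (begin
  n + (u + n * e) ≡⟨ sym (+-assoc n u (n * e)) ⟩
  n + u + n * e   ≡⟨ cong (_+ n * e) (+-comm n u) ⟩
  u + n + n * e   ≡⟨ +-assoc u n (n * e) ⟩
  u + (n + n * e) ≡⟨ cong (u +_) (sym (*-suc n e)) ⟩
  u + n * suc e   ≡⟨ eq ⟩
  n + j           ∎)
  where open ≡-Reasoning

quotient-bound : ∀ {n i j e} → 1 ≤ n → i ≤ n → j ≤ n → n + n * e ≡ i + j → ¬ (suc (suc n) ≤ j + e)
quotient-bound {n} {i} {j} {e} 1≤n i≤n j≤n eq room = <⇒≱ (m<m+n n 1≤n) (+-cancelˡ-≤ n _ _ (begin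
  n + (n + n)     ≡⟨ cong (n +_) (sym (trans (*-comm n 2) (cong (n +_) (+-identityʳ n)))) ⟩
  n + n * 2       ≤⟨ +-monoʳ-≤ n (*-monoʳ-≤ n 2≤e) ⟩
  n + n * e       ≡⟨ eq ⟩
  i + j           ≤⟨ +-mono-≤ i≤n j≤n ⟩
  n + n           ∎))
  where
  open ≤-Reasoning
  2≤e : 2 ≤ e
  2≤e = +-cancelˡ-≤ n 2 e (≤-trans (≤-reflexive (+-comm n 2)) (≤-trans room (+-monoˡ-≤ e j≤n)))

<2^suc⌊log₂⌋ : ∀ n → n < 2 ^ suc ⌊log₂ n ⌋
<2^suc⌊log₂⌋ n with n <? 2 ^ suc ⌊log₂ n ⌋
... | yes n< = n<
... | no  n≮ = contradiction (⌊log₂⌋-mono-≤ (≮⇒≥ n≮)) (<⇒≱ (begin-strict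
  ⌊log₂ n ⌋                   <⟨ n<1+n _ ⟩
  suc ⌊log₂ n ⌋               ≡⟨ sym (⌊log₂[2^n]⌋≡n (suc ⌊log₂ n ⌋)) ⟩
  ⌊log₂ 2 ^ suc ⌊log₂ n ⌋ ⌋   ∎))
  where open ≤-Reasoning

-- The machine

module PeriodMachine (σ : ℕ) where

  Cell : Set
  Cell = Fin (suc σ)

  Sym : Set
  Sym = Fin (suc (suc σ))

  pattern blank    = Fin.zero
  pattern cell x   = Fin.suc x
  pattern sep      = Fin.zero
  pattern letter a = Fin.suc a

  -- n is the length of the input, N the number of blocks on stream 1, the flag
  -- of copying and returning says whether N ≥ n + 3, and in comparing n j i ok
  -- head 1 is at letter i of block j while ok records whether w[x] = w[x + j]
  -- for all x < i with x + j < n.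
  data State : Set where
    counting   : ℕ → State
    rewinding  : ℕ → ℕ → State
    copying    : Bool → ℕ → ℕ → State
    returning  : Bool → ℕ → ℕ → State
    appending  : ℕ → ℕ → State
    restarting : ℕ → State
    comparing  : ℕ → ℕ → ℕ → Bool → State

  data Instr : Set where
    output : ℕ → Instr
    go     : State → Sym → Sym → Move → Move → Instr

  enough : ℕ → ℕ → Bool
  enough n N = does (3 + n ≤? N)

  sameLetter : Fin σ → Sym → Bool
  sameLetter a (cell (letter b)) = does (a Fin.≟ b)
  sameLetter a _                 = false

  -- Defined by matching on the Dec, so that proofs can split on it with `with`.
  whenever : ∀ {P : Set} → Dec P → Bool → Bool
  whenever (yes _) b = b
  whenever (no _)  _ = true

  agree : ℕ → ℕ → ℕ → Fin σ → Sym → Bool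
  agree n j i a t = whenever (i + j <? n) (sameLetter a t)

  endOfBlock : ℕ → ℕ → Bool → Sym → Instr
  endOfBlock n (suc j) true t = output (suc j)
  endOfBlock n j       ok   t = go (comparing n (suc j) 0 true) (cell sep) t mvR mvR

  -- Head 2 moves along while counting only so that both heads have begun a
  -- rightward pass when the doubling rounds start.
  next : State → Sym → Sym → Instr
  next (counting c)       (cell x) t        = go (counting (suc c)) (cell x) t mvR mvR
  next (counting zero)    blank    t        = output 1
  next (counting (suc c)) blank    t        = go (rewinding (suc c) 1) (cell sep) t mvL stay
  next (rewinding n N)    (cell x) t        = go (rewinding n N) (cell x) t mvL stay
  next (rewinding n N)    blank    t        = go (copying (enough n N) n N) blank t mvR stay
  next (copying f n N)    (cell x) t        = go (copying f n N) (cell x) (cell x) mvR mvR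
  next (copying f n N)    blank    t        = go (returning f n N) blank t stay mvL
  next (returning f n N)  s        (cell y) = go (returning f n N) s (cell y) stay mvL
  next (returning true n N)  s     blank    = go (restarting n) s blank mvL mvR
  next (returning false n N) s     blank    = go (appending n N) s blank stay mvR
  next (appending n N)    s        (cell y) = go (appending n N) (cell y) blank mvR mvR
  next (appending n N)    s        blank    = go (rewinding n (N + N)) s blank mvL stay
  next (restarting n)     (cell x) t        = go (restarting n) (cell x) t mvL stay
  next (restarting n)     blank    t        = go (comparing n 0 0 true) blank t mvR stay
  next (comparing n j i ok) s (cell sep)    = go (comparing n j i ok) s (cell sep) stay mvR
  next (comparing n j i ok) blank t         = output 0   -- unreachable
  next (comparing n j i ok) (cell sep) t    = endOfBlock n j ok t
  next (comparing n j i ok) (cell (letter a)) t =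
    go (comparing n j (suc i) (ok ∧ agree n j i a t)) (cell (letter a)) t mvR mvR

  Tag : Set
  Tag = Bool × Bool × Bool × Bool

  tag : State → Tag
  tag (counting _)         = false , false , false , false
  tag (rewinding _ _)      = false , false , true  , false
  tag (copying f _ _)      = false , true  , false , f
  tag (returning f _ _)    = false , true  , true  , f
  tag (appending _ _)      = true  , false , false , false
  tag (restarting _)       = true  , false , true  , false
  tag (comparing _ _ _ ok) = true  , true  , false , ok

  counters : State → List ℕ
  counters (counting c)        = c ∷ []
  counters (rewinding n N)     = n ∷ N ∷ []
  counters (copying _ n N)     = n ∷ N ∷ []
  counters (returning _ n N)   = n ∷ N ∷ []
  counters (appending n N)     = n ∷ N ∷ []
  counters (restarting n)      = n ∷ []
  counters (comparing n j i _) = n ∷ j ∷ i ∷ []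

  parse : Tag → List ℕ → Maybe State
  parse (false , false , false , _) (c ∷ [])         = just (counting c)
  parse (false , false , true  , _) (n ∷ N ∷ [])     = just (rewinding n N)
  parse (false , true  , false , f) (n ∷ N ∷ [])     = just (copying f n N)
  parse (false , true  , true  , f) (n ∷ N ∷ [])     = just (returning f n N)
  parse (true  , false , false , _) (n ∷ N ∷ [])     = just (appending n N)
  parse (true  , false , true  , _) (n ∷ [])         = just (restarting n)
  parse (true  , true  , false , f) (n ∷ j ∷ i ∷ []) = just (comparing n j i f)
  parse _ _ = nothing

  parse-tag : ∀ st → parse (tag st) (counters st) ≡ just st
  parse-tag (counting _)        = refl
  parse-tag (rewinding _ _)     = refl
  parse-tag (copying _ _ _)     = refl
  parse-tag (returning _ _ _)   = refl
  parse-tag (appending _ _)     = refl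
  parse-tag (restarting _)      = refl
  parse-tag (comparing _ _ _ _) = refl

  bits : Tag → List Bool
  bits (a , b , c , d) = a ∷ b ∷ c ∷ d ∷ []

  encode : State → List Bool
  encode st = bits (tag st) ++ codes (counters st)

  decode : List Bool → Maybe State
  decode (a ∷ b ∷ c ∷ d ∷ bs) = decodeAll bs Maybe.>>= parse (a , b , c , d)
  decode _                    = nothing

  decode-encode : ∀ st → decode (encode st) ≡ just st
  decode-encode st =
    trans (cong (Maybe._>>= parse (tag st)) (decodeAll-codes (counters st))) (parse-tag st)

  toAction : Instr → Action (suc (suc σ))
  toAction (output o)      = halt o
  toAction (go st a b d e) = step (encode st) a b d e

  machine : Machine σ
  machine = record
    { k     = suc (suc σ)
    ; blank = blank
    ; inj   = cell ∘ letter
    ; mem₀  = encode (counting 0)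
    ; δ     = λ mem s t → Maybe.maybe (λ st → toAction (next st s t)) (halt 0) (decode mem)
    }

  δ-encode : ∀ st s t → Machine.δ machine (encode st) s t ≡ toAction (next st s t)
  δ-encode st s t rewrite decode-encode st = refl

  Tape′ : Set
  Tape′ = Tape (suc (suc σ))

  -- L ▸ Y: the head is on the first cell of Y (on a blank if Y = []), and L
  -- lists the symbols left of the head, nearest first.
  infixr 5 _▸_
  _▸_ : List Sym → List Cell → Tape′
  L ▸ []      = tape L blank []
  L ▸ (y ∷ Y) = tape L (cell y) (map cell Y)

  move-right : ∀ a L y Y → moveTape blank mvR (writeTape a (L ▸ y ∷ Y)) ≡ (a ∷ L) ▸ Y
  move-right a L y []      = refl
  move-right a L y (_ ∷ _) = refl

  -- Equality up to trailing blanks: moving off either end of a tape adds one.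
  infix 4 _≋_ _≈ₜ_
  _≋_ : List Sym → List Sym → Set
  []       ≋ []       = ⊤
  []       ≋ (y ∷ ys) = y ≡ blank × [] ≋ ys
  (x ∷ xs) ≋ []       = x ≡ blank × xs ≋ []
  (x ∷ xs) ≋ (y ∷ ys) = x ≡ y × xs ≋ ys

  _≈ₜ_ : Tape′ → Tape′ → Set
  tape l c r ≈ₜ tape l′ c′ r′ = l ≋ l′ × c ≡ c′ × r ≋ r′

  ≋-refl : ∀ xs → xs ≋ xs
  ≋-refl []       = tt
  ≋-refl (x ∷ xs) = refl , ≋-refl xs

  blanks-≋ : ∀ k {B} → [] ≋ B → [] ≋ replicate k blank ʳ++ B
  blanks-≋ zero    B≋ = B≋
  blanks-≋ (suc k) B≋ = blanks-≋ k (refl , B≋)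

  ≈ₜ-refl : ∀ t → t ≈ₜ t
  ≈ₜ-refl (tape l c r) = ≋-refl l , refl , ≋-refl r

  ≈ₜ-reflexive : ∀ {t t′} → t ≡ t′ → t ≈ₜ t′
  ≈ₜ-reflexive {t} refl = ≈ₜ-refl t

  ≈ₜ-cur : ∀ {t t′} → t ≈ₜ t′ → Tape.cur t ≡ Tape.cur t′
  ≈ₜ-cur {tape _ _ _} {tape _ _ _} (_ , c≡c′ , _) = c≡c′

  ≈ₜ-move : ∀ {t t′} a d → t ≈ₜ t′ →
    moveTape blank d (writeTape a t) ≈ₜ moveTape blank d (writeTape a t′)
  ≈ₜ-move {tape l c r} {tape l′ c′ r′} a stay (l≋ , _ , r≋) = l≋ , refl , r≋
  ≈ₜ-move {tape l c []} {tape l′ c′ []} a mvR (l≋ , _ , _) = (refl , l≋) , refl , tt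
  ≈ₜ-move {tape l c []} {tape l′ c′ (_ ∷ _)} a mvR (l≋ , _ , (e , r≋)) = (refl , l≋) , sym e , r≋
  ≈ₜ-move {tape l c (_ ∷ _)} {tape l′ c′ []} a mvR (l≋ , _ , (e , r≋)) = (refl , l≋) , e , r≋
  ≈ₜ-move {tape l c (_ ∷ _)} {tape l′ c′ (_ ∷ _)} a mvR (l≋ , _ , (e , r≋)) = (refl , l≋) , e , r≋
  ≈ₜ-move {tape [] c r} {tape [] c′ r′} a mvL (_ , _ , r≋) = tt , refl , (refl , r≋)
  ≈ₜ-move {tape [] c r} {tape (_ ∷ _) c′ r′} a mvL ((e , l≋) , _ , r≋) = l≋ , sym e , (refl , r≋)
  ≈ₜ-move {tape (_ ∷ _) c r} {tape [] c′ r′} a mvL ((e , l≋) , _ , r≋) = l≋ , e , (refl , r≋)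
  ≈ₜ-move {tape (_ ∷ _) c r} {tape (_ ∷ _) c′ r′} a mvL ((e , l≋) , _ , r≋) = l≋ , e , (refl , r≋)

  Runs-≈ : ∀ {m p mem t₁ t₂ t₁′ t₂′ h₁ h₂ o} → t₁ ≈ₜ t₁′ → t₂ ≈ₜ t₂′ →
    Runs machine m p (config mem t₁ t₂ h₁ h₂) o → Runs machine m p (config mem t₁′ t₂′ h₁ h₂) o
  Runs-≈ e₁ e₂ (halts δ≡ m≤ p≤) rewrite ≈ₜ-cur e₁ | ≈ₜ-cur e₂ = halts δ≡ m≤ p≤
  Runs-≈ e₁ e₂ (steps {a₁ = a₁} {a₂} {d₁} {d₂} δ≡ m≤ r) rewrite ≈ₜ-cur e₁ | ≈ₜ-cur e₂ =
    steps δ≡ m≤ (Runs-≈ (≈ₜ-move a₁ d₁ e₁) (≈ₜ-move a₂ d₂ e₂) r)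

  rightward leftward : ℕ → HeadLog
  rightward q = hlog (just dR) q
  leftward  q = hlog (just dL) q

  conf : State → Tape′ → Tape′ → HeadLog → HeadLog → Config (suc (suc σ))
  conf st = config (encode st)

  memoryBound : ℕ → ℕ
  memoryBound K = 4 + 3 * (1 + K * 2)

  length-counters : ∀ st → length (counters st) ≤ 3
  length-counters (counting _)        = s≤s z≤n
  length-counters (rewinding _ _)     = s≤s (s≤s z≤n)
  length-counters (copying _ _ _)     = s≤s (s≤s z≤n)
  length-counters (returning _ _ _)   = s≤s (s≤s z≤n)
  length-counters (appending _ _)     = s≤s (s≤s z≤n)
  length-counters (restarting _)      = s≤s z≤n
  length-counters (comparing _ _ _ _) = ≤-refl

  length-encode : ∀ K st → All (_< 2 ^ K) (counters st) → length (encode st) ≤ memoryBound K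
  length-encode K st small = s≤s (s≤s (s≤s (s≤s (≤-trans (length-codes K small)
    (*-monoˡ-≤ (1 + K * 2) (length-counters st))))))

  word : ∀ {n} → Vec (Fin σ) n → List Cell
  word w = map letter (Vec.toList w)

  block : ∀ {n} → Vec (Fin σ) n → List Cell
  block w = word w ++ sep ∷ []

  length-word : ∀ {n} (w : Vec (Fin σ) n) → length (word w) ≡ n
  length-word w = trans (length-map letter (Vec.toList w)) (length-toList w)

  drop-word : ∀ {k} (v : Vec (Fin σ) k) T i (i<k : i < k) →
    drop i (word v ++ T) ≡ letter (lookup v (fromℕ< i<k)) ∷ drop (suc i) (word v ++ T)
  drop-word (a Vec.∷ v) T zero    _         = refl
  drop-word (a Vec.∷ v) T (suc i) (s≤s i<k) = drop-word v T i i<k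

  drop-word-length : ∀ {k} (v : Vec (Fin σ) k) T → drop k (word v ++ T) ≡ T
  drop-word-length Vec.[]      T = refl
  drop-word-length (a Vec.∷ v) T = drop-word-length v T

  agree-reflects : ∀ {n} (w : Vec (Fin σ) n) {j i} (i<n : i < n) b →
    (∀ (q : i + j < n) → b ≡ lookup w (fromℕ< q)) →
    Reflects (ShiftInvariantAt w j i i<n) (agree n j i (lookup w (fromℕ< i<n)) (cell (letter b)))
  agree-reflects {n} w {j} {i} i<n b b≡ with i + j <? n
  ... | no  i+j≮n = ofʸ (λ q → contradiction q i+j≮n)
  ... | yes q with lookup w (fromℕ< i<n) Fin.≟ b
  ...   | yes a≡b = ofʸ (λ q′ → trans a≡b (b≡ q′))
  ...   | no  a≢b = ofⁿ (λ at → a≢b (trans (at q) (sym (b≡ q))))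

  initConfig-word : ∀ {n} (w : Vec (Fin σ) n) →
    initConfig machine w ≡ conf (counting 0) ([] ▸ word w) ([] ▸ []) (hlog nothing 0) (hlog nothing 0)
  initConfig-word w = cong (λ t → config _ t _ _ _) (inputTape-word w)
    where
    inputTape-word : ∀ {n} (w : Vec (Fin σ) n) → inputTape machine w ≡ [] ▸ word w
    inputTape-word Vec.[]            = refl
    inputTape-word (a Vec.∷ Vec.[])  = refl
    inputTape-word (a Vec.∷ b Vec.∷ w) =
      cong (λ r → tape [] (cell (letter a)) (cell (letter b) ∷ r)) (cong Tape.rgt (inputTape-word (b Vec.∷ w)))

  record MinPeriodRun (m p : ℕ) {n} (w : Vec (Fin σ) n) (c : Config (suc (suc σ))) : Set where
    constructor found
    field
      period  : ℕ
      minimal : IsMinPeriod w period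
      runs    : Runs machine m p c period

  module Bounded (m p K : ℕ) (memory-fits : memoryBound K ≤ m) where

    record Small (st : State) : Set where
      constructor bounded
      field counters< : All (_< 2 ^ K) (counters st)
    open Small

    infix 4 _⇝_
    _⇝_ : Config (suc (suc σ)) → Config (suc (suc σ)) → Set
    c ⇝ c′ = ∀ {o} → Runs machine m p c′ o → Runs machine m p c o

    ⇝-≡ : ∀ {c c′} → c ≡ c′ → c ⇝ c′
    ⇝-≡ refl r = r

    ⇝-tape₁ : ∀ {st L Y Y′ t₂ h₁ h₂} → Y ≡ Y′ →
      conf st (L ▸ Y) t₂ h₁ h₂ ⇝ conf st (L ▸ Y′) t₂ h₁ h₂
    ⇝-tape₁ refl r = r

    ⇝-tape₂ : ∀ {st t₁ L Y Y′ h₁ h₂} → Y ≡ Y′ →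
      conf st t₁ (L ▸ Y) h₁ h₂ ⇝ conf st t₁ (L ▸ Y′) h₁ h₂
    ⇝-tape₂ refl r = r

    advance-≈ : ∀ {st st′ t₁ t₂ t₁′ t₂′ h₁ h₂ a₁ a₂ d₁ d₂} → Small st →
      next st (Tape.cur t₁) (Tape.cur t₂) ≡ go st′ a₁ a₂ d₁ d₂ →
      t₁′ ≈ₜ moveTape blank d₁ (writeTape a₁ t₁) → t₂′ ≈ₜ moveTape blank d₂ (writeTape a₂ t₂) →
      conf st t₁ t₂ h₁ h₂ ⇝ conf st′ t₁′ t₂′ (logMove d₁ h₁) (logMove d₂ h₂)
    advance-≈ {st} small next≡ t₁≈ t₂≈ r =
      steps (trans (δ-encode st _ _) (cong toAction next≡))
            (≤-trans (length-encode K st (counters< small)) memory-fits) (Runs-≈ t₁≈ t₂≈ r)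

    advance : ∀ {st st′ t₁ t₂ t₁′ t₂′ h₁ h₂ a₁ a₂ d₁ d₂} → Small st →
      next st (Tape.cur t₁) (Tape.cur t₂) ≡ go st′ a₁ a₂ d₁ d₂ →
      moveTape blank d₁ (writeTape a₁ t₁) ≡ t₁′ → moveTape blank d₂ (writeTape a₂ t₂) ≡ t₂′ →
      conf st t₁ t₂ h₁ h₂ ⇝ conf st′ t₁′ t₂′ (logMove d₁ h₁) (logMove d₂ h₂)
    advance small next≡ refl refl = advance-≈ small next≡ (≈ₜ-refl _) (≈ₜ-refl _)

    stop : ∀ {st t₁ t₂ h₁ h₂ o} → Small st → next st (Tape.cur t₁) (Tape.cur t₂) ≡ output o →
      passesOf h₁ + passesOf h₂ ≤ p → Runs machine m p (conf st t₁ t₂ h₁ h₂) o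
    stop {st} small next≡ passes =
      halts (trans (δ-encode st _ _) (cong toAction next≡))
            (≤-trans (length-encode K st (counters< small)) memory-fits) passes

    counting-⇝ : ∀ X l B {c} → length (X ʳ++ l) ≡ c → c < 2 ^ K →
      conf (counting (length l)) (map cell l ▸ X) (B ▸ []) (rightward 0) (rightward 0) ⇝
      conf (counting c) (map cell (X ʳ++ l) ▸ [])
           ((replicate (length X) blank ʳ++ B) ▸ []) (rightward 0) (rightward 0)
    counting-⇝ []      l B refl _     = id
    counting-⇝ (x ∷ X) l B total c< r =
      advance small refl (move-right (cell x) (map cell l) x X) refl
        (counting-⇝ X (x ∷ l) (blank ∷ B) total c< r)
      where
      small : Small (counting (length l))
      small = bounded (≤-<-trans (≤-trans (n≤1+n _) (m≤n+m _ (length X)))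
                                 (subst (_< 2 ^ K) (trans (sym total) (length-ʳ++ X)) c<) ∷ [])

    rewind-⇝ : ∀ {st st′ t₂ h₂ q} → Small st →
      (∀ x → next st (cell x) (Tape.cur t₂) ≡ go st (cell x) (Tape.cur t₂) mvL stay) →
      next st blank (Tape.cur t₂) ≡ go st′ blank (Tape.cur t₂) mvR stay →
      ∀ W Y → 0 < length W →
      conf st (moveTape blank mvL (map cell (reverse W) ▸ Y)) t₂ (leftward q) h₂ ⇝
      conf st′ ([] ▸ W ++ Y) t₂ (rightward (suc q)) h₂
    rewind-⇝ {st} {st′} {t₂} {h₂} {q} small left atBlank W Y 0<W
      with reverse W | reverse-involutive W
    ... | []    | refl = contradiction 0<W n≮0
    ... | z ∷ l | refl = λ r → atEnd Y (⇝-tape₁ {st′} (ʳ++-defn (z ∷ l)) r)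
      where
      rewinding-⇝ : ∀ l y Y → conf st (map cell l ▸ y ∷ Y) t₂ (leftward q) h₂ ⇝
                              conf st′ ([] ▸ l ʳ++ y ∷ Y) t₂ (rightward (suc q)) h₂
      rewinding-⇝ []      y Y r =
        advance small (left y) refl refl
          (advance-≈ small atBlank ((refl , tt) , refl , ≋-refl _) (≈ₜ-refl _) r)
      rewinding-⇝ (z ∷ l) y Y r = advance small (left y) refl refl (rewinding-⇝ l z (y ∷ Y) r)

      atEnd : ∀ Y → conf st (moveTape blank mvL (map cell (z ∷ l) ▸ Y)) t₂ (leftward q) h₂ ⇝
                    conf st′ ([] ▸ l ʳ++ z ∷ Y) t₂ (rightward (suc q)) h₂
      atEnd []      r = Runs-≈ (≋-refl _ , refl , (refl , tt)) (≈ₜ-refl _) (rewinding-⇝ l z [] r)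
      atEnd (_ ∷ _) r = rewinding-⇝ l z _ r

    counting-phase-⇝ : ∀ {n′} (w : Vec (Fin σ) (suc n′)) → suc n′ < 2 ^ K →
      initConfig machine w ⇝
      conf (copying (enough (suc n′) 1) (suc n′) 1) ([] ▸ block w) ([] ▸ []) (rightward 2) (rightward 0)
    counting-phase-⇝ {n′} w@(a Vec.∷ w′) n< r =
      ⇝-≡ (initConfig-word w)
        (advance (bounded {counting 0} (m^n>0 2 K ∷ [])) refl
                 (move-right (cell (letter a)) [] (letter a) (word w′)) refl
          (counting-⇝ (word w′) (letter a ∷ []) (blank ∷ []) length-reverse-word n<
            (advance-≈ (bounded {counting (suc n′)} (n< ∷ [])) refl (≈ₜ-refl _)
                       (blanks-≋ (length (word w′)) (refl , tt) , refl , tt)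
              (rewind-⇝ (bounded {rewinding (suc n′) 1} (n< ∷ ≤-<-trans (s≤s z≤n) n< ∷ []))
                        (λ _ → refl) refl
                 (word w) (sep ∷ []) (s≤s z≤n) r))))
      where
      length-reverse-word : length (reverse (word w)) ≡ suc n′
      length-reverse-word = trans (length-reverse (word w)) (length-word w)

    rewind-from-end-⇝ : ∀ {st st′ t₂ h₂ q} → Small st →
      (∀ x → next st (cell x) (Tape.cur t₂) ≡ go st (cell x) (Tape.cur t₂) mvL stay) →
      next st blank (Tape.cur t₂) ≡ go st′ blank (Tape.cur t₂) mvR stay →
      ∀ W → 0 < length W →
      conf st (moveTape blank mvL (map cell (reverse W) ▸ [])) t₂ (leftward q) h₂ ⇝
      conf st′ ([] ▸ W) t₂ (rightward (suc q)) h₂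
    rewind-from-end-⇝ {st′ = st′} small left atBlank W 0<W r =
      rewind-⇝ small left atBlank W [] 0<W (⇝-tape₁ {st′} (++-identityʳ W) r)

    return-from-end-⇝ : ∀ {f n N st′ t₁ h₁ d₁ q} → Small (returning f n N) →
      next (returning f n N) (Tape.cur t₁) blank ≡ go st′ (Tape.cur t₁) blank d₁ mvR →
      ∀ W → 0 < length W →
      conf (returning f n N) t₁ (moveTape blank mvL (map cell (reverse W) ▸ [])) h₁ (leftward q) ⇝
      conf st′ (moveTape blank d₁ t₁) ([] ▸ W) (logMove d₁ h₁) (rightward (suc q))
    return-from-end-⇝ {f} {n} {N} {st′} {t₁} {h₁} {d₁} {q} small atBlank W 0<W
      with reverse W | reverse-involutive W
    ... | []    | refl = contradiction 0<W n≮0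
    ... | z ∷ l | refl = λ r →
      Runs-≈ (≈ₜ-refl _) (≋-refl _ , refl , (refl , tt))
        (returning-⇝ l z [] r)
      where
      returning-⇝ : ∀ l y Y → conf (returning f n N) t₁ (map cell l ▸ y ∷ Y) h₁ (leftward q) ⇝
                              conf st′ (moveTape blank d₁ t₁) ([] ▸ l ʳ++ y ∷ Y)
                                   (logMove d₁ h₁) (rightward (suc q))
      returning-⇝ []      y Y r =
        advance small refl refl refl
          (advance-≈ small atBlank (≈ₜ-refl _) ((refl , tt) , refl , ≋-refl _) r)
      returning-⇝ (z ∷ l) y Y r = advance small refl refl refl (returning-⇝ l z (y ∷ Y) r)

    copying-⇝ : ∀ {f n N q₁ q₂} → Small (copying f n N) → ∀ X l₁ l₂ →
      conf (copying f n N) (map cell l₁ ▸ X) (map cell l₂ ▸ []) (rightward q₁) (rightward q₂) ⇝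
      conf (copying f n N) (map cell (X ʳ++ l₁) ▸ []) (map cell (X ʳ++ l₂) ▸ [])
           (rightward q₁) (rightward q₂)
    copying-⇝ small []      l₁ l₂ = id
    copying-⇝ small (x ∷ X) l₁ l₂ r =
      advance small refl (move-right (cell x) (map cell l₁) x X) refl
        (copying-⇝ small X (x ∷ l₁) (x ∷ l₂) r)

    appending-⇝ : ∀ {n N q₁ q₂} → Small (appending n N) → ∀ Y l₁ L₂ →
      conf (appending n N) (map cell l₁ ▸ []) (L₂ ▸ Y) (rightward q₁) (rightward q₂) ⇝
      conf (appending n N) (map cell (Y ʳ++ l₁) ▸ []) ((replicate (length Y) blank ʳ++ L₂) ▸ [])
           (rightward q₁) (rightward q₂)
    appending-⇝ small []      l₁ L₂ = id
    appending-⇝ small (y ∷ Y) l₁ L₂ r =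
      advance small refl refl (move-right blank L₂ y Y) (appending-⇝ small Y (y ∷ l₁) (blank ∷ L₂) r)

    copy-and-return-⇝ : ∀ {f n N st′ d₁ q₁ q₂} → Small (copying f n N) → Small (returning f n N) →
      next (returning f n N) blank blank ≡ go st′ blank blank d₁ mvR →
      ∀ X → 0 < length X →
      conf (copying f n N) ([] ▸ X) ([] ▸ []) (rightward q₁) (rightward q₂) ⇝
      conf st′ (moveTape blank d₁ (map cell (reverse X) ▸ [])) ([] ▸ X)
           (logMove d₁ (rightward q₁)) (rightward (2 + q₂))
    copy-and-return-⇝ copySmall returnSmall atBlank X 0<X r =
      copying-⇝ copySmall X [] []
        (advance copySmall refl refl refl (return-from-end-⇝ returnSmall atBlank X 0<X r))

    doubling-round-⇝ : ∀ {n N q₁ q₂} → Small (copying false n N) → Small (returning false n N) →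
      Small (appending n N) → Small (rewinding n (N + N)) → ∀ X → 0 < length X →
      conf (copying false n N) ([] ▸ X) ([] ▸ []) (rightward q₁) (rightward q₂) ⇝
      conf (copying (enough n (N + N)) n (N + N)) ([] ▸ X ++ X) ([] ▸ [])
           (rightward (2 + q₁)) (rightward (2 + q₂))
    doubling-round-⇝ copySmall returnSmall appendSmall rewindSmall X 0<X r =
      copy-and-return-⇝ copySmall returnSmall refl X 0<X
        (appending-⇝ appendSmall X (reverse X) []
          (advance-≈ appendSmall refl
            (≈ₜ-reflexive (cong (λ L → moveTape blank mvL (map cell L ▸ [])) (++-ʳ++ X)))
            (blanks-≋ (length X) tt , refl , tt)
            (rewind-from-end-⇝ rewindSmall (λ _ → refl) refl (X ++ X) 0<X++X r)))
      where
      0<X++X : 0 < length (X ++ X)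
      0<X++X = <-≤-trans 0<X (≤-trans (m≤m+n _ _) (≤-reflexive (sym (length-++ X))))

    final-copy-⇝ : ∀ {n N q₁ q₂} → Small (copying true n N) → Small (returning true n N) →
      Small (restarting n) → ∀ X → 0 < length X →
      conf (copying true n N) ([] ▸ X) ([] ▸ []) (rightward q₁) (rightward q₂) ⇝
      conf (comparing n 0 0 true) ([] ▸ X) ([] ▸ X) (rightward (2 + q₁)) (rightward (2 + q₂))
    final-copy-⇝ copySmall returnSmall restartSmall X 0<X r =
      copy-and-return-⇝ copySmall returnSmall refl X 0<X
        (rewind-from-end-⇝ restartSmall (λ _ → refl) refl X 0<X r)

    ⇝-minPeriodRun : ∀ {n} {w : Vec (Fin σ) n} {c c′} →
      c ⇝ c′ → MinPeriodRun m p w c′ → MinPeriodRun m p w c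
    ⇝-minPeriodRun c⇝c′ (found ℓ isMin r) = found ℓ isMin (c⇝c′ r)

    module Comparison {n′} (w : Vec (Fin σ) (suc n′)) (n<2^K : suc n′ < 2 ^ K)
                      (q₁ q₂ : ℕ) (passes : suc q₁ + suc q₂ ≤ p) where

      n : ℕ
      n = suc n′

      rest : ℕ → ℕ → List Cell
      rest i M = drop i (block w) ++ copies M (block w)

      rest-letter : ∀ i M (i<n : i < n) → rest i M ≡ letter (lookup w (fromℕ< i<n)) ∷ rest (suc i) M
      rest-letter i M i<n = cong (_++ copies M (block w)) (drop-word w (sep ∷ []) i i<n)

      rest-length : ∀ M → rest n M ≡ sep ∷ copies M (block w)
      rest-length M = cong (_++ copies M (block w)) (drop-word-length w (sep ∷ []))

      comparingAt : ℕ → ℕ → Bool → List Cell → List Cell → List Cell → List Cell → Config (suc (suc σ))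
      comparingAt j i ok T₁ T₂ l₁ l₂ =
        conf (comparing n j i ok) (map cell l₁ ▸ T₁) (map cell l₂ ▸ T₂) (rightward q₁) (rightward q₂)

      -- Head 2 has read i + j letters: e whole copies of w, then u letters of the
      -- current block.  M₁ and M₂ count the blocks after the current one.
      record Position (j i u e M₁ M₂ : ℕ) : Set where
        constructor position
        field
          j≤n   : j ≤ n
          i≤n   : i ≤ n
          u≤n   : u ≤ n
          read₂ : u + n * e ≡ i + j
          room₁ : suc n ≤ j + M₁
          room₂ : suc (suc n) ≤ j + e + M₂

      small : ∀ {j i ok} → j ≤ n → i ≤ n → Small (comparing n j i ok)
      small j≤n i≤n = bounded (n<2^K ∷ ≤-<-trans j≤n n<2^K ∷ ≤-<-trans i≤n n<2^K ∷ [])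

      BlockStart : ℕ → Set
      BlockStart j = ∀ {u e M₁ M₂} l₁ l₂ → Position j 0 u e M₁ M₂ → NoShorterPeriod w j →
        MinPeriodRun m p w (comparingAt j 0 true (rest 0 M₁) (rest u M₂) l₁ l₂)

      next-block : ∀ {j ok u e M₁ M₂} l₁ l₂ (u<n : u < n) →
        let b = lookup w (fromℕ< u<n) in
        endOfBlock n j ok (cell (letter b)) ≡ go (comparing n (suc j) 0 true) (cell sep) (cell (letter b)) mvR mvR →
        ¬ IsPeriod w j → NoShorterPeriod w j → Position j n u e M₁ M₂ → (j < n → BlockStart (suc j)) →
        MinPeriodRun m p w (comparingAt j n ok (sep ∷ copies M₁ (block w)) (letter b ∷ rest (suc u) M₂) l₁ l₂)
      next-block {j} {M₁ = zero} l₁ l₂ u<n _ ¬period _ (position j≤n _ _ _ room₁ _) _ =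
        contradiction (non-period<length w (s≤s z≤n) j≤n ¬period)
                      (≤⇒≯ (≤-trans (n≤1+n n) (≤-trans room₁ (≤-reflexive (+-identityʳ j)))))
      next-block {j} {u = u} {M₁ = suc M₁} {M₂ = M₂} l₁ l₂ u<n endOfBlock≡ ¬period none
                 (position j≤n _ _ read₂ room₁ room₂) continue
        with quotient-suc u<n read₂
      ... | e′ , refl , read₂′ =
        ⇝-minPeriodRun
          (advance (small j≤n ≤-refl) endOfBlock≡
            (move-right (cell sep) (map cell l₁) sep (copies (suc M₁) (block w)))
            (move-right (cell (letter b)) (map cell l₂) (letter b) (rest (suc u) M₂)))
          (continue j<n (sep ∷ l₁) (letter b ∷ l₂)
            (position j<n z≤n u<n (cong suc read₂′)
              (≤-trans room₁ (≤-reflexive (+-suc j M₁)))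
              (≤-trans room₂ (≤-reflexive (cong (_+ M₂) (+-suc j e′)))))
            (noShorterPeriod-suc w none ¬period))
        where
        b = lookup w (fromℕ< u<n)
        j<n : j < n
        j<n = non-period<length w (s≤s z≤n) j≤n ¬period

      block-end : ∀ {j ok u e M₁ M₂} l₁ l₂ (u<n : u < n) →
        Reflects (ShiftInvariantBelow w j n) ok → NoShorterPeriod w j → Position j n u e M₁ M₂ →
        (j < n → BlockStart (suc j)) →
        MinPeriodRun m p w (comparingAt j n ok (sep ∷ copies M₁ (block w))
                                           (letter (lookup w (fromℕ< u<n)) ∷ rest (suc u) M₂) l₁ l₂)
      block-end {zero} l₁ l₂ u<n _ = next-block l₁ l₂ u<n refl (λ { (() , _) })
      block-end {suc j} l₁ l₂ u<n (ofʸ below) none pos _ =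
        found (suc j) (isMinPeriod w (s≤s z≤n) (shiftInvariantBelow-length w below) none)
          (stop (small (Position.j≤n pos) ≤-refl) refl passes)
      block-end {suc j} l₁ l₂ u<n (ofⁿ ¬below) =
        next-block l₁ l₂ u<n refl (¬below ∘ shiftInvariant⇒below w ∘ proj₂)

      mutual
        scan : ∀ k {j i u e M₁ M₂ ok} l₁ l₂ → i + k ≡ n → Position j i u e M₁ M₂ →
          Reflects (ShiftInvariantBelow w j i) ok → NoShorterPeriod w j → (j < n → BlockStart (suc j)) →
          MinPeriodRun m p w (comparingAt j i ok (rest i M₁) (rest u M₂) l₁ l₂)
        scan k l₁ l₂ i+k≡n pos with m≤n⇒m<n∨m≡n (Position.u≤n pos)
        ... | inj₁ u<n  = scan-letter k l₁ l₂ i+k≡n u<n pos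
        ... | inj₂ refl = skip-separator k l₁ l₂ i+k≡n pos

        skip-separator : ∀ k {j i e M₁ M₂ ok} l₁ l₂ → i + k ≡ n → Position j i n e M₁ M₂ →
          Reflects (ShiftInvariantBelow w j i) ok → NoShorterPeriod w j → (j < n → BlockStart (suc j)) →
          MinPeriodRun m p w (comparingAt j i ok (rest i M₁) (rest n M₂) l₁ l₂)
        skip-separator k {j} {i} {e} {M₂ = zero} l₁ l₂ _ (position j≤n i≤n _ read₂ _ room₂) =
          contradiction (≤-trans room₂ (≤-reflexive (+-identityʳ (j + e))))
                        (quotient-bound (s≤s z≤n) i≤n j≤n read₂)
        skip-separator k {j} {i} {e} {M₁} {suc M₂} {ok} l₁ l₂ i+k≡n
                       (position j≤n i≤n _ read₂ room₁ room₂) agrees none continue =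
          ⇝-minPeriodRun (⇝-tape₂ {comparing n j i ok} (rest-length (suc M₂)))
            (⇝-minPeriodRun
              (advance (small j≤n i≤n) refl refl (move-right (cell sep) (map cell l₂) sep (rest 0 M₂)))
              (scan-letter k l₁ (sep ∷ l₂) i+k≡n (s≤s z≤n)
                (position j≤n i≤n z≤n (trans (*-suc n e) read₂) room₁
                  (≤-trans room₂ (≤-reflexive (trans (+-suc (j + e) M₂) (cong (_+ M₂) (sym (+-suc j e)))))))
                agrees none continue))

        scan-letter : ∀ k {j i u e M₁ M₂ ok} l₁ l₂ → i + k ≡ n → (u<n : u < n) → Position j i u e M₁ M₂ →
          Reflects (ShiftInvariantBelow w j i) ok → NoShorterPeriod w j → (j < n → BlockStart (suc j)) →
          MinPeriodRun m p w (comparingAt j i ok (rest i M₁) (rest u M₂) l₁ l₂)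
        scan-letter zero {j} {i} {u} {M₁ = M₁} {M₂} {ok} l₁ l₂ i+0≡n u<n pos agrees none continue
          with trans (sym (+-identityʳ i)) i+0≡n
        ... | refl =
          ⇝-minPeriodRun (⇝-tape₁ {comparing n j n ok} (rest-length M₁))
            (⇝-minPeriodRun (⇝-tape₂ {comparing n j n ok} (rest-letter u M₂ u<n))
              (block-end l₁ l₂ u<n agrees none pos continue))
        scan-letter (suc k) {j} {i} {u} {e} {M₁} {M₂} {ok} l₁ l₂ i+k≡n u<n
                    (position j≤n i≤n _ read₂ room₁ room₂) agrees none continue =
          ⇝-minPeriodRun (⇝-tape₁ {comparing n j i ok} (rest-letter i M₁ i<n))
            (⇝-minPeriodRun (⇝-tape₂ {comparing n j i ok} (rest-letter u M₂ u<n))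
              (⇝-minPeriodRun
                (advance (small j≤n i≤n) refl
                  (move-right (cell (letter a)) (map cell l₁) (letter a) (rest (suc i) M₁))
                  (move-right (cell (letter b)) (map cell l₂) (letter b) (rest (suc u) M₂)))
                (scan k (letter a ∷ l₁) (letter b ∷ l₂) (trans (sym (+-suc i k)) i+k≡n)
                  (position j≤n i<n u<n (cong suc read₂) room₁ room₂)
                  (shiftInvariantBelow-suc-reflects w i<n agrees (agree-reflects w i<n b b-at))
                  none continue)))
          where
          i<n : i < n
          i<n = ≤-trans (s≤s (m≤m+n i k)) (≤-reflexive (trans (sym (+-suc i k)) i+k≡n))
          a = lookup w (fromℕ< i<n)
          b = lookup w (fromℕ< u<n)
          b-at : ∀ (q : i + j < n) → b ≡ lookup w (fromℕ< q)
          b-at q = cong (lookup w) (fromℕ<-cong u (i + j) u≡i+j u<n q)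
            where
            u≡i+j : u ≡ i + j
            u≡i+j = begin
              u             ≡⟨ sym (+-identityʳ u) ⟩
              u + 0         ≡⟨ cong (u +_) (sym (*-zeroʳ n)) ⟩
              u + n * 0     ≡⟨ cong (λ e → u + n * e) (sym (quotient-zero {u = u} read₂ q)) ⟩
              u + n * e     ≡⟨ read₂ ⟩
              i + j         ∎
              where open ≡-Reasoning

      all-blocks : ∀ d j → d + j ≡ n → BlockStart j
      all-blocks zero    j j≡n       l₁ l₂ pos none =
        scan n l₁ l₂ refl pos (ofʸ (shiftInvariantBelow-zero w j)) none (contradiction j≡n ∘ <⇒≢)
      all-blocks (suc d) j d+1+j≡n l₁ l₂ pos none =
        scan n l₁ l₂ refl pos (ofʸ (shiftInvariantBelow-zero w j)) none
          (λ _ → all-blocks d (suc j) (trans (+-suc d j) d+1+j≡n))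

      comparison : ∀ N → suc (suc n) ≤ N →
        MinPeriodRun m p w (conf (comparing n 0 0 true) ([] ▸ copies (suc N) (block w))
                             ([] ▸ copies (suc N) (block w)) (rightward q₁) (rightward q₂))
      comparison N room =
        all-blocks n 0 (+-identityʳ n) [] []
          (position z≤n z≤n z≤n (*-zeroʳ n) (≤-trans (n≤1+n _) room) room) (λ _ _ ())

    doubling : ∀ {n′} (w : Vec (Fin σ) (suc n′)) →
      suc n′ < 2 ^ K → (3 + suc n′) + (3 + suc n′) ≤ 2 ^ K →
      ∀ d N q₁ q₂ → 1 ≤ N → N < 2 ^ K → 3 + suc n′ ≤ 2 ^ d * N → 3 + q₁ + (3 + q₂) + 4 * d ≤ p →
      MinPeriodRun m p w (conf (copying (enough (suc n′) N) (suc n′) N) ([] ▸ copies N (block w))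
                               ([] ▸ []) (rightward q₁) (rightward q₂))
    -- `enough` normalises past the Dec, so `does` and `proof` are abstracted separately.
    doubling {n′} w n< room d N q₁ q₂ _ N< enough-at-d budget
      with enough (suc n′) N | proof (3 + suc n′ ≤? N)
    doubling {n′} w@(_ Vec.∷ _) n< room d (suc N) q₁ q₂ _ N< _ budget | true | ofʸ 3+n≤N =
      ⇝-minPeriodRun
        (final-copy-⇝ (bounded (n< ∷ N< ∷ [])) (bounded (n< ∷ N< ∷ [])) (bounded (n< ∷ []))
                      (copies (suc N) (block w)) (s≤s z≤n))
        (Comparison.comparison w n< (2 + q₁) (2 + q₂) (m+n≤o⇒m≤o _ budget) N (≤-pred 3+n≤N))
    doubling {n′} w _ _ zero N q₁ q₂ _ _ enough-at-0 _ | false | ofⁿ 3+n≰N =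
      contradiction (≤-trans enough-at-0 (≤-reflexive (*-identityˡ N))) 3+n≰N
    doubling {n′} w@(_ Vec.∷ _) n< room (suc d) (suc N) q₁ q₂ _ N< enough-at-d budget | false | ofⁿ 3+n≰N =
      ⇝-minPeriodRun
        (doubling-round-⇝ (bounded (n< ∷ N< ∷ [])) (bounded (n< ∷ N< ∷ [])) (bounded (n< ∷ N< ∷ []))
                          (bounded (n< ∷ 2N< ∷ [])) (copies (suc N) (block w)) (s≤s z≤n))
        (⇝-minPeriodRun (⇝-tape₁ {copying (enough (suc n′) 2N) (suc n′) 2N}
                                 (copies-+ (suc N) (suc N) (block w)))
          (doubling w n< room d 2N (2 + q₁) (2 + q₂) (s≤s z≤n) 2N<
            (≤-trans enough-at-d (≤-reflexive (doubled (2 ^ d) (suc N))))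
            (≤-trans (≤-reflexive (round-passes q₁ q₂ d)) budget)))
      where
      2N : ℕ
      2N = suc N + suc N
      2N< : 2N < 2 ^ K
      2N< = <-≤-trans (+-mono-< (≰⇒> 3+n≰N) (≰⇒> 3+n≰N)) room
      doubled : ∀ x y → (2 * x) * y ≡ x * (y + y)
      doubled = solve-∀
      round-passes : ∀ q₁ q₂ d → 3 + (2 + q₁) + (3 + (2 + q₂)) + 4 * d ≡ 3 + q₁ + (3 + q₂) + 4 * suc d
      round-passes = solve-∀

  -- Resource bounds

  memory-fits : ∀ L → memoryBound (3 + L) ≤ 32 * (1 + L)
  memory-fits L = begin
    4 + 3 * (1 + (3 + L) * 2) ≡⟨ expand L ⟩
    25 + 6 * L                ≤⟨ +-mono-≤ (m≤m+n 25 7) (*-monoˡ-≤ L (m≤m+n 6 26)) ⟩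
    32 + 32 * L               ≡⟨ sym (*-distribˡ-+ 32 1 L) ⟩
    32 * (1 + L)              ∎
    where
    open ≤-Reasoning
    expand : ∀ L → 4 + 3 * (1 + (3 + L) * 2) ≡ 25 + 6 * L
    expand = solve-∀

  computesMinPeriod : ∀ n (w : Vec (Fin σ) n) →
    MinPeriodRun (32 * (1 + ⌊log₂ n ⌋)) (32 * (1 + ⌊log₂ n ⌋) ^ 2) w (initConfig machine w)
  computesMinPeriod zero Vec.[] =
    found 1 ((s≤s z≤n , λ ()) , λ _ → proj₁)
      (stop (bounded {counting 0} (m^n>0 2 3 ∷ [])) refl (s≤s (s≤s z≤n)))
    where open Bounded 32 32 3 (memory-fits 0)
  computesMinPeriod (suc n′) w =
    ⇝-minPeriodRun (counting-phase-⇝ w n<2^K)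
      (⇝-minPeriodRun (⇝-tape₁ {copying (enough n 1) n 1} (sym (++-identityʳ (block w))))
        (doubling w n<2^K room (2 + L) 1 2 0 ≤-refl (≤-<-trans (s≤s z≤n) n<2^K)
          (≤-trans 3+n≤4P (≤-reflexive (sym (*-identityʳ _)))) budget))
    where
    n = suc n′
    L = ⌊log₂ n ⌋
    P = 2 ^ L
    open Bounded (32 * (1 + L)) (32 * (1 + L) ^ 2) (3 + L) (memory-fits L)
    3+n≤4P : 3 + n ≤ 2 * (2 * P)
    3+n≤4P = begin
      2 + suc n     ≤⟨ +-monoˡ-≤ (suc n) (s≤s (s≤s z≤n)) ⟩
      suc n + suc n ≡⟨ cong (suc n +_) (sym (+-identityʳ (suc n))) ⟩
      2 * suc n     ≤⟨ *-monoʳ-≤ 2 (<2^suc⌊log₂⌋ n) ⟩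
      2 * (2 * P)   ∎
      where open ≤-Reasoning
    room : (3 + n) + (3 + n) ≤ 2 ^ (3 + L)
    room = +-mono-≤ 3+n≤4P (≤-trans 3+n≤4P (≤-reflexive (sym (+-identityʳ _))))
    n<2^K : n < 2 ^ (3 + L)
    n<2^K = ≤-trans (m≤n+m (suc n) 2) (≤-trans (m≤m+n (3 + n) (3 + n)) room)
    budget : 3 + 2 + (3 + 0) + 4 * (2 + L) ≤ 32 * (1 + L) ^ 2
    budget = begin
      3 + 2 + (3 + 0) + 4 * (2 + L) ≡⟨ expand L ⟩
      16 + 4 * L                    ≤⟨ +-mono-≤ (m≤m+n 16 16) (*-monoˡ-≤ L (m≤m+n 4 28)) ⟩
      32 + 32 * L                   ≡⟨ sym (*-distribˡ-+ 32 1 L) ⟩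
      32 * (1 + L)                  ≤⟨ *-monoʳ-≤ 32 (m≤m*n (1 + L) _) ⟩
      32 * (1 + L) ^ 2              ∎
      where
      open ≤-Reasoning
      expand : ∀ L → 3 + 2 + (3 + 0) + 4 * (2 + L) ≡ 16 + 4 * L
      expand = solve-∀

corollary4 : (σ : ℕ) →
    Σ (Machine σ) λ M → Σ ℕ λ c →
      (n : ℕ) (w : Vec (Fin σ) n) →
        Σ ℕ λ ℓ → IsMinPeriod w ℓ ×
          ComputesWithin M w (c * (1 + ⌊log₂ n ⌋)) (c * (1 + ⌊log₂ n ⌋) ^ 2) ℓ
corollary4 σ = machine , 32 , λ n w →
  let open MinPeriodRun (computesMinPeriod n w) in period , minimal , runs
  where open PeriodMachine σ
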